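{- Let $G$ be a claw-free graph that is not cobipartite, has distinct neighbourhoods, and has diameter $2$. Let $(A,B)$ be an unshatterable proper W-join of $G$. For adjacent vertices $a\in A$ and $b\in B$, let $G_{ab}$ be the graph obtained from $G$ by removing $A\setminus\{a\}$ and $B\setminus\{b\}$. Then $G$ admits a disconnected cut if and only if $G_{ab}$ admits a disconnected cut, for any two adjacent vertices $a\in A$ and $b\in B$.
   Context: Graphs are finite, simple, undirected; claw-free means no induced $K_{1,3}$; cobipartite means the complement is bipartite. $N(u)$ is the neighbourhood of $u$. Two adjacent vertices $u,v$ have nested neighbourhoods if $N(u)\setminus\{v\}\subseteq N(v)\setminus\{u\}$ or $N(v)\setminus\{u\}\subseteq N(u)\setminus\{v\}$; $G$ has distinct neighbourhoods if no two vertices have nested neighbourhoods. Disjoint sets $S,T$ are complete if all edges between them are present and anticomplete if none are. A pair $(A,B)$ of disjoint non-empty vertex sets is a W-join if $|A|+|B|>2$, $A$ and $B$ are cliques, $A$ is neither complete nor anticomplete to $B$, and every vertex outside $A\cup B$ is either complete or anticomplete to $A$ and either complete or anticomplete to $B$; it is proper if each vertex of $A$ is neither complete nor anticomplete to $B$ and vice versa. A W-join $(A,B)$ is partitionable if there are partitions of $A$ into non-empty $A',A''$ and of $B$ into non-empty $B',B''$ with $A'$ anticomplete to $B''$ and $B'$ anticomplete to $A''$. A proper W-join is shatterable if it is partitionable with such sets where one of $(A',B')$, $(A'',B'')$ is also a proper W-join, and unshatterable otherwise. For connected $H$, a disconnected cut is a vertex set $U$ with $H-U$ and $H[U]$ both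 disconnected. -}

module Defs where

open import Data.Nat using (ℕ; _+_; _>_)
open import Data.Fin using (Fin)
open import Data.Fin.Subset using (Subset; _∈_; _∉_; _⊆_; _∪_; _∩_; _─_; ⁅_⁆; ⊤; ⊥; ∣_∣; Nonempty)
open import Data.Product using (Σ; ∃; ∃-syntax; _×_; _,_)
open import Data.Sum using (_⊎_)
import Data.Empty
open import Relation.Nullary using (¬_)
open import Relation.Binary.PropositionalEquality using (_≡_; _≢_)

record Graph (n : ℕ) : Set₁ where
  field
    Adj    : Fin n → Fin n → Set
    sym    : ∀ {u v} → Adj u v → Adj v u
    irrefl : ∀ {u} → ¬ Adj u u
open Graph public

module _ {n : ℕ} (G : Graph n) where

  Complete : Subset n → Subset n → Set
  Complete S T = ∀ {x y} → x ∈ S → y ∈ T → Adj G x y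

  Anticomplete : Subset n → Subset n → Set
  Anticomplete S T = ∀ {x y} → x ∈ S → y ∈ T → ¬ Adj G x y

  Clique : Subset n → Set
  Clique S = ∀ {x y} → x ∈ S → y ∈ S → x ≢ y → Adj G x y

  ClawFree : Set
  ClawFree = ∀ c x y z → Adj G c x → Adj G c y → Adj G c z →
             x ≢ y → x ≢ z → y ≢ z →
             ¬ Adj G x y → ¬ Adj G x z → ¬ Adj G y z → Data.Empty.⊥

  Cobipartite : Set
  Cobipartite = ∃[ X ] ∃[ Y ] (X ∪ Y ≡ ⊤ × X ∩ Y ≡ ⊥ × Clique X × Clique Y)

  NbhIncluded : Fin n → Fin n → Set
  NbhIncluded u v = ∀ w → Adj G u w → w ≢ v → Adj G v w × w ≢ u

  Nested : Fin n → Fin n → Set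
  Nested u v = Adj G u v × (NbhIncluded u v ⊎ NbhIncluded v u)

  DistinctNeighbourhoods : Set
  DistinctNeighbourhoods = ∀ u v → ¬ Nested u v

  Dist≤2 : Fin n → Fin n → Set
  Dist≤2 u v = u ≡ v ⊎ Adj G u v ⊎ (∃[ w ] (Adj G u w × Adj G w v))

  Diameter2 : Set
  Diameter2 = (∀ u v → Dist≤2 u v) × (∃[ u ] ∃[ v ] (u ≢ v × ¬ Adj G u v))

  WJoin : Subset n → Subset n → Set
  WJoin A B =
    A ∩ B ≡ ⊥ × Nonempty A × Nonempty B × ∣ A ∣ + ∣ B ∣ > 2 ×
    Clique A × Clique B × ¬ Complete A B × ¬ Anticomplete A B ×
    (∀ x → x ∉ A ∪ B →
       (Complete ⁅ x ⁆ A ⊎ Anticomplete ⁅ x ⁆ A) ×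
       (Complete ⁅ x ⁆ B ⊎ Anticomplete ⁅ x ⁆ B))

  ProperWJoin : Subset n → Subset n → Set
  ProperWJoin A B = WJoin A B ×
    (∀ a → a ∈ A → ¬ Complete ⁅ a ⁆ B × ¬ Anticomplete ⁅ a ⁆ B) ×
    (∀ b → b ∈ B → ¬ Complete ⁅ b ⁆ A × ¬ Anticomplete ⁅ b ⁆ A)

  PartitionWitness : Subset n → Subset n → Subset n → Subset n → Subset n → Subset n → Set
  PartitionWitness A B A' A'' B' B'' =
    A' ∪ A'' ≡ A × A' ∩ A'' ≡ ⊥ × Nonempty A' × Nonempty A'' ×
    B' ∪ B'' ≡ B × B' ∩ B'' ≡ ⊥ × Nonempty B' × Nonempty B'' ×
    Anticomplete A' B'' × Anticomplete B' A''

  Partitionable : Subset n → Subset n → Set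
  Partitionable A B = WJoin A B × ∃[ A' ] ∃[ A'' ] ∃[ B' ] ∃[ B'' ] PartitionWitness A B A' A'' B' B''

  Shatterable : Subset n → Subset n → Set
  Shatterable A B = ProperWJoin A B ×
    ∃[ A' ] ∃[ A'' ] ∃[ B' ] ∃[ B'' ]
      (PartitionWitness A B A' A'' B' B'' × (ProperWJoin A' B' ⊎ ProperWJoin A'' B''))

  Unshatterable : Subset n → Subset n → Set
  Unshatterable A B = ProperWJoin A B × ¬ Shatterable A B

  Disconnected : Subset n → Set
  Disconnected T = ∃[ X ] ∃[ Y ]
    (X ∪ Y ≡ T × X ∩ Y ≡ ⊥ × Nonempty X × Nonempty Y × Anticomplete X Y)

  HasDisconnectedCut : Subset n → Set
  HasDisconnectedCut S = ∃[ U ] (U ⊆ S × Disconnected (S ─ U) × Disconnected U)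

  Gab : Subset n → Subset n → Fin n → Fin n → Subset n
  Gab A B a b = ⊤ ─ ((A ─ ⁅ a ⁆) ∪ (B ─ ⁅ b ⁆))

module Submission where

-- A disconnected cut of an induced subgraph G[S] is the same thing as a colouring of
-- S with four colours, forming two pairs of opposite colours, that uses every colour
-- and never gives opposite colours to adjacent vertices: the cut U is the set of
-- vertices coloured from the first pair, and the colours of each pair are the two
-- sides of U and of S ─ U (cut⇒colouring, colouring⇒cut).  So it suffices to move
-- colourings between G and G_ab.
--
-- Backward: colour A like a and B like b ('paint'); since (A , B) is a W-join this is
-- valid on G.  Forward: restrict a colouring of G to G_ab.  If a and b share a colour,
-- every colour still occurs in G_ab ('monochrome', by diameter 2).  Otherwise a and b
-- get colours of different pairs; when the colour opposite to a (or to b) is missing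
-- outside A ∪ B, the module NoOppositeOutside shows, using diameter 2, distinct
-- neighbourhoods and that G is not cobipartite (through the lemma 'lonely'), that
-- repainting A and B with the colours opposite to b and to a gives a colouring of G_ab.

open import Defs renaming (sym to adj-sym)
open import Data.Nat using (ℕ)
open import Data.Bool using (Bool; true; false; not)
open import Data.Bool.Properties using (not-involutive; not-¬; ¬-not) renaming (_≟_ to _≟ᵇ_)
open import Data.Fin using (Fin) renaming (_≟_ to _≟ᶠ_)
open import Data.Fin.Properties using (any?)
open import Data.Fin.Subset using (Subset; _∈_; _∉_; _⊆_; _∪_; _∩_; _─_; ⁅_⁆; ⊤; ⊥)
open import Data.Fin.Subset.Properties
  using (_∈?_; ∈⊤; ⊆⊤; ∉⊥; ⊆-antisym; Empty-unique; x∈p∪q⁺; x∈p∪q⁻; x∈p∩q⁺; x∈p∩q⁻;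
         x∈p∧x∉q⇒x∈p─q; p─q⊆p; x∈⁅x⁆; x≢y⇒x∉⁅y⁆)
open import Data.Vec using (_∷_; here; there; tabulate)
open import Data.Vec.Properties using (lookup∘tabulate; []=⇒lookup; lookup⇒[]=)
open import Data.Product using (Σ; ∃; ∃-syntax; _×_; _,_; proj₁; proj₂; swap)
open import Data.Product.Properties using (≡-dec)
open import Data.Sum using (_⊎_; inj₁; inj₂; [_,_])
open import Data.Unit using (tt) renaming (⊤ to Unit)
open import Data.Empty using (⊥-elim) renaming (⊥ to Empty)
open import Function using (_∘_)
open import Relation.Nullary using (¬_; Dec; yes; no; does; contradiction)
open import Relation.Nullary.Decidable using (dec-true; _×-dec_; ¬?)
open import Relation.Unary using (Decidable)
open import Relation.Binary.PropositionalEquality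
  using (_≡_; _≢_; refl; sym; trans; cong; cong₂; subst)

x∈p─q⇒x∉q : ∀ {n} {p q : Subset n} {x} → x ∈ p ─ q → x ∉ q
x∈p─q⇒x∉q {p = _ ∷ _}     {q = _ ∷ _}    (there x∈p─q) (there x∈q) = x∈p─q⇒x∉q x∈p─q x∈q
x∈p─q⇒x∉q {p = true ∷ _}  {q = true ∷ _} () here
x∈p─q⇒x∉q {p = false ∷ _} {q = true ∷ _} () here

∈-disjoint : ∀ {n} {p q : Subset n} {x} → p ∩ q ≡ ⊥ → x ∈ p → x ∉ q
∈-disjoint {x = x} p∩q≡⊥ x∈p x∈q = ∉⊥ (subst (x ∈_) p∩q≡⊥ (x∈p∩q⁺ (x∈p , x∈q)))

⟦_⟧ : ∀ {n} {P : Fin n → Set} → Decidable P → Subset n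
⟦ P? ⟧ = tabulate (λ v → does (P? v))

∈⟦⟧⁺ : ∀ {n} {P : Fin n → Set} (P? : Decidable P) {v} → P v → v ∈ ⟦ P? ⟧
∈⟦⟧⁺ P? {v} pv = lookup⇒[]= v _ (trans (lookup∘tabulate (λ u → does (P? u)) v) (dec-true (P? v) pv))

∈⟦⟧⁻ : ∀ {n} {P : Fin n → Set} (P? : Decidable P) {v} → v ∈ ⟦ P? ⟧ → P v
∈⟦⟧⁻ P? {v} v∈ with P? v | trans (sym (lookup∘tabulate (λ u → does (P? u)) v)) ([]=⇒lookup v∈)
... | yes pv | _  = pv
... | no _   | ()

∉-removed : ∀ {n} {p : Subset n} {x v} → v ∉ p ─ ⁅ x ⁆ → v ∈ p → v ≡ x
∉-removed {x = x} {v} v∉ v∈p with v ≟ᶠ x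
... | yes v≡x = v≡x
... | no v≢x  = contradiction (x∈p∧x∉q⇒x∈p─q v∈p (x≢y⇒x∉⁅y⁆ v≢x)) v∉

∈-removed : ∀ {n} {p : Subset n} {x v} → v ∈ p ─ ⁅ x ⁆ → ¬ (v ∈ p → v ≡ x)
∈-removed {p = p} {x} v∈ only-x =
  x∈p─q⇒x∉q v∈ (subst (_∈ ⁅ x ⁆) (sym (only-x (p─q⊆p p ⁅ x ⁆ v∈))) (x∈⁅x⁆ x))

InGab : ∀ {n} → Subset n → Subset n → Fin n → Fin n → Fin n → Set
InGab A B a b v = (v ∈ A → v ≡ a) × (v ∈ B → v ≡ b)

∈Gab⇒InGab : ∀ {n} (G : Graph n) {A B a b v} → v ∈ Gab G A B a b → InGab A B a b v
∈Gab⇒InGab G v∈ =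
  ∉-removed (λ h → v∉ (x∈p∪q⁺ (inj₁ h))) , ∉-removed (λ h → v∉ (x∈p∪q⁺ (inj₂ h)))
  where v∉ = x∈p─q⇒x∉q v∈

InGab⇒∈Gab : ∀ {n} (G : Graph n) {A B a b v} → InGab A B a b v → v ∈ Gab G A B a b
InGab⇒∈Gab G {A} {B} {a} {b} (only-a , only-b) = x∈p∧x∉q⇒x∈p─q ∈⊤ λ h →
  [ (λ h′ → ∈-removed h′ only-a) , (λ h′ → ∈-removed h′ only-b) ] (x∈p∪q⁻ (A ─ ⁅ a ⁆) (B ─ ⁅ b ⁆) h)

-- Four colours (i , s): i names one of two pairs, and the two colours of a pair are opposite.
Colour : Set
Colour = Bool × Bool

pair : Colour → Bool
pair = proj₁

opp : Colour → Colour
opp c = pair c , not (proj₂ c)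

_≟ᶜ_ : (c d : Colour) → Dec (c ≡ d)
_≟ᶜ_ = ≡-dec _≟ᵇ_ _≟ᵇ_

Clash : Colour → Colour → Set
Clash c d = d ≡ opp c

opp-involutive : ∀ c → opp (opp c) ≡ c
opp-involutive (i , s) = cong (i ,_) (not-involutive s)

clash-sym : ∀ {c d} → Clash c d → Clash d c
clash-sym {c} refl = sym (opp-involutive c)

no-self-clash : ∀ {c} → ¬ Clash c c
no-self-clash c≡opp-c = not-¬ refl (cong proj₂ c≡opp-c)

no-clash-resp : ∀ {c d k l} → c ≡ k → d ≡ l → ¬ Clash k l → ¬ Clash c d
no-clash-resp refl refl no-clash = no-clash

cross-pair : ∀ {c d} → pair c ≢ pair d → ¬ Clash c d
cross-pair pair≢ d≡opp-c = pair≢ (sym (cong pair d≡opp-c))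

same-pair : ∀ {c e} → pair e ≡ pair c → e ≡ c ⊎ e ≡ opp c
same-pair {c} {e} pair≡ with proj₂ e ≟ᵇ proj₂ c
... | yes side≡ = inj₁ (cong₂ _,_ pair≡ side≡)
... | no side≢  = inj₂ (cong₂ _,_ pair≡ (¬-not side≢))

four-colours : ∀ {c d} → pair c ≢ pair d → ∀ e → e ≡ c ⊎ e ≡ opp c ⊎ e ≡ d ⊎ e ≡ opp d
four-colours {c} {d} pair≢ e with pair e ≟ᵇ pair c
... | yes pair≡ with same-pair pair≡
...   | inj₁ e≡c  = inj₁ e≡c
...   | inj₂ e≡c′ = inj₂ (inj₁ e≡c′)
four-colours {c} {d} pair≢ e | no pair≢′
  with same-pair {d} {e} (trans (¬-not pair≢′) (sym (¬-not (pair≢ ∘ sym))))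
...   | inj₁ e≡d  = inj₂ (inj₂ (inj₁ e≡d))
...   | inj₂ e≡d′ = inj₂ (inj₂ (inj₂ e≡d′))

-- The same fact, in the form used to refute a case by excluding all four colours.
no-fifth-colour : ∀ {c d} → pair c ≢ pair d →
                  ∀ {e} → e ≢ c → e ≢ opp c → e ≢ d → e ≢ opp d → Empty
no-fifth-colour pair≢ {e} e≢c e≢c′ e≢d e≢d′ = [ e≢c , [ e≢c′ , [ e≢d , e≢d′ ] ] ] (four-colours pair≢ e)

module _ {n : ℕ} (G : Graph n) where

  adj⇒≢ : ∀ {u w} → Adj G u w → w ≢ u
  adj⇒≢ uw refl = irrefl G uw

  no-dominated-neighbour : DistinctNeighbourhoods G → ∀ {u v} → Adj G u v →
                           (∀ {w} → Adj G u w → w ≢ v → Adj G v w) → Empty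
  no-dominated-neighbour distinct {u} {v} uv dominated =
    distinct u v (uv , inj₁ (λ w uw w≢v → dominated uw w≢v , adj⇒≢ uw))

  Valid : (Fin n → Set) → (Fin n → Colour) → Set
  Valid S col = ∀ {u v} → S u → S v → Adj G u v → ¬ Clash (col u) (col v)

  Surjective : (Fin n → Set) → (Fin n → Colour) → Set
  Surjective S col = ∀ k → ∃[ v ] (S v × col v ≡ k)

  Colouring : (Fin n → Set) → Set
  Colouring S = Σ (Fin n → Colour) λ col → Valid S col × Surjective S col

  colouring-resp : ∀ {S T : Fin n → Set} → (∀ {v} → S v → T v) → (∀ {v} → T v → S v) →
                   Colouring S → Colouring T
  colouring-resp S⇒T T⇒S (col , valid , surj) =
    col , (λ u v uv → valid (T⇒S u) (T⇒S v) uv) , λ k → let (v , Sv , e) = surj k in v , S⇒T Sv , e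

  module CutColouring {S U P Q X Y : Subset n} (U⊆S : U ⊆ S)
    (P∪Q : P ∪ Q ≡ S ─ U) (P∩Q : P ∩ Q ≡ ⊥) (P-Q : Anticomplete G P Q)
    (X∪Y : X ∪ Y ≡ U) (X∩Y : X ∩ Y ≡ ⊥) (X-Y : Anticomplete G X Y) where

    block : Colour → Subset n
    block (false , false) = X
    block (false , true)  = Y
    block (true  , false) = P
    block (true  , true)  = Q

    in-U : ∀ {s v} → v ∈ block (false , s) → v ∈ U
    in-U {false} v∈ = subst (_ ∈_) X∪Y (x∈p∪q⁺ (inj₁ v∈))
    in-U {true}  v∈ = subst (_ ∈_) X∪Y (x∈p∪q⁺ (inj₂ v∈))

    in-S─U : ∀ {s v} → v ∈ block (true , s) → v ∈ S ─ U
    in-S─U {false} v∈ = subst (_ ∈_) P∪Q (x∈p∪q⁺ (inj₁ v∈))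
    in-S─U {true}  v∈ = subst (_ ∈_) P∪Q (x∈p∪q⁺ (inj₂ v∈))

    block⊆S : ∀ k {v} → v ∈ block k → v ∈ S
    block⊆S (false , _) v∈ = U⊆S (in-U v∈)
    block⊆S (true  , _) v∈ = p─q⊆p S U (in-S─U v∈)

    block-unique : ∀ k l {v} → v ∈ block k → v ∈ block l → k ≡ l
    block-unique (false , false) (false , false) _   _   = refl
    block-unique (false , true)  (false , true)  _   _   = refl
    block-unique (true  , false) (true  , false) _   _   = refl
    block-unique (true  , true)  (true  , true)  _   _   = refl
    block-unique (false , false) (false , true)  v∈X v∈Y = ⊥-elim (∈-disjoint X∩Y v∈X v∈Y)
    block-unique (false , true)  (false , false) v∈Y v∈X = ⊥-elim (∈-disjoint X∩Y v∈X v∈Y)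
    block-unique (true  , false) (true  , true)  v∈P v∈Q = ⊥-elim (∈-disjoint P∩Q v∈P v∈Q)
    block-unique (true  , true)  (true  , false) v∈Q v∈P = ⊥-elim (∈-disjoint P∩Q v∈P v∈Q)
    block-unique (false , _)     (true  , _)     v∈U v∈R = ⊥-elim (x∈p─q⇒x∉q (in-S─U v∈R) (in-U v∈U))
    block-unique (true  , _)     (false , _)     v∈R v∈U = ⊥-elim (x∈p─q⇒x∉q (in-S─U v∈R) (in-U v∈U))

    block-anticomplete : ∀ k → Anticomplete G (block k) (block (opp k))
    block-anticomplete (false , false) = X-Y
    block-anticomplete (false , true)  = λ u∈Y v∈X uv → X-Y v∈X u∈Y (adj-sym G uv)
    block-anticomplete (true  , false) = P-Q
    block-anticomplete (true  , true)  = λ u∈Q v∈P uv → P-Q v∈P u∈Q (adj-sym G uv)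

    col : Fin n → Colour
    col v with v ∈? Y | v ∈? P | v ∈? Q
    ... | yes _ | _     | _     = false , true
    ... | no _  | yes _ | _     = true  , false
    ... | no _  | no _  | yes _ = true  , true
    ... | no _  | no _  | no _  = false , false

    block-of-col : ∀ {v} → v ∈ S → v ∈ block (col v)
    block-of-col {v} v∈S with v ∈? Y | v ∈? P | v ∈? Q
    ... | yes v∈Y | _       | _       = v∈Y
    ... | no _    | yes v∈P | _       = v∈P
    ... | no _    | no _    | yes v∈Q = v∈Q
    ... | no v∉Y  | no v∉P  | no v∉Q  with v ∈? U
    ...   | yes v∈U = [ (λ v∈X → v∈X) , (λ v∈Y → contradiction v∈Y v∉Y) ]
                        (x∈p∪q⁻ X Y (subst (v ∈_) (sym X∪Y) v∈U))
    ...   | no v∉U  = [ (λ v∈P → contradiction v∈P v∉P) , (λ v∈Q → contradiction v∈Q v∉Q) ]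
                        (x∈p∪q⁻ P Q (subst (v ∈_) (sym P∪Q) (x∈p∧x∉q⇒x∈p─q v∈S v∉U)))

    valid : Valid (_∈ S) col
    valid {u} {v} u∈S v∈S uv clash =
      block-anticomplete (col u) (block-of-col u∈S)
        (subst (λ k → v ∈ block k) clash (block-of-col v∈S)) uv

    surjective : (∀ k → ∃[ v ] (v ∈ block k)) → Surjective (_∈ S) col
    surjective witness k = let (v , v∈) = witness k; v∈S = block⊆S k v∈ in
      v , v∈S , block-unique (col v) k (block-of-col v∈S) v∈

  cut⇒colouring : ∀ {S} → HasDisconnectedCut G S → Colouring (_∈ S)
  cut⇒colouring (U , U⊆S , (P , Q , P∪Q , P∩Q , P≠∅ , Q≠∅ , P-Q) ,
                           (X , Y , X∪Y , X∩Y , X≠∅ , Y≠∅ , X-Y)) =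
    col , valid , surjective λ { (false , false) → X≠∅ ; (false , true) → Y≠∅
                               ; (true , false) → P≠∅ ; (true , true) → Q≠∅ }
    where open CutColouring U⊆S P∪Q P∩Q P-Q X∪Y X∩Y X-Y

  module ColouringCut {S : Subset n} (col : Fin n → Colour) (valid : Valid (_∈ S) col) where

    in-class? : (k : Colour) → Decidable (λ v → v ∈ S × col v ≡ k)
    in-class? k v = (v ∈? S) ×-dec (col v ≟ᶜ k)

    in-side? : (i : Bool) → Decidable (λ v → v ∈ S × pair (col v) ≡ i)
    in-side? i v = (v ∈? S) ×-dec (pair (col v) ≟ᵇ i)

    class : Colour → Subset n
    class k = ⟦ in-class? k ⟧

    side : Bool → Subset n
    side i = ⟦ in-side? i ⟧

    side⊆S : ∀ {i v} → v ∈ side i → v ∈ S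
    side⊆S {i} v∈ = proj₁ (∈⟦⟧⁻ (in-side? i) v∈)

    class-split : ∀ i → class (i , false) ∪ class (i , true) ≡ side i
    class-split i = ⊆-antisym into-side into-classes
      where
      into-side : ∀ {v} → v ∈ class (i , false) ∪ class (i , true) → v ∈ side i
      into-side v∈ with x∈p∪q⁻ (class (i , false)) (class (i , true)) v∈
      ... | inj₁ h = let (v∈S , e) = ∈⟦⟧⁻ (in-class? _) h in ∈⟦⟧⁺ (in-side? i) (v∈S , cong pair e)
      ... | inj₂ h = let (v∈S , e) = ∈⟦⟧⁻ (in-class? _) h in ∈⟦⟧⁺ (in-side? i) (v∈S , cong pair e)
      one-of : ∀ s {v} → v ∈ class (i , s) → v ∈ class (i , false) ∪ class (i , true)
      one-of false h = x∈p∪q⁺ (inj₁ h)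
      one-of true  h = x∈p∪q⁺ (inj₂ h)
      into-classes : ∀ {v} → v ∈ side i → v ∈ class (i , false) ∪ class (i , true)
      into-classes {v} v∈ = let (v∈S , e) = ∈⟦⟧⁻ (in-side? i) v∈ in
        one-of (proj₂ (col v)) (∈⟦⟧⁺ (in-class? _) (v∈S , cong (_, proj₂ (col v)) e))

    side-true : side true ≡ S ─ side false
    side-true = ⊆-antisym into into⁻
      where
      into : ∀ {v} → v ∈ side true → v ∈ S ─ side false
      into v∈ = let (v∈S , e) = ∈⟦⟧⁻ (in-side? true) v∈ in
        x∈p∧x∉q⇒x∈p─q v∈S (λ h → not-¬ refl (trans (sym e) (proj₂ (∈⟦⟧⁻ (in-side? false) h))))
      into⁻ : ∀ {v} → v ∈ S ─ side false → v ∈ side true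
      into⁻ v∈ = ∈⟦⟧⁺ (in-side? true)
        (p─q⊆p S _ v∈ , ¬-not (λ e → x∈p─q⇒x∉q v∈ (∈⟦⟧⁺ (in-side? false) (p─q⊆p S _ v∈ , e))))

    class-disjoint : ∀ k → class k ∩ class (opp k) ≡ ⊥
    class-disjoint k = Empty-unique λ { (v , v∈) →
      let (h , h′) = x∈p∩q⁻ (class k) (class (opp k)) v∈ in
      no-self-clash (trans (sym (proj₂ (∈⟦⟧⁻ (in-class? _) h))) (proj₂ (∈⟦⟧⁻ (in-class? _) h′))) }

    class-anticomplete : ∀ k → Anticomplete G (class k) (class (opp k))
    class-anticomplete k u∈ v∈ uv =
      let (u∈S , eu) = ∈⟦⟧⁻ (in-class? _) u∈; (v∈S , ev) = ∈⟦⟧⁻ (in-class? _) v∈ in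
      valid u∈S v∈S uv (trans ev (cong opp (sym eu)))

    class-nonempty : Surjective (_∈ S) col → ∀ k → ∃[ v ] (v ∈ class k)
    class-nonempty surj k = let (v , v∈S , e) = surj k in v , ∈⟦⟧⁺ (in-class? k) (v∈S , e)

  colouring⇒cut : ∀ {S} → Colouring (_∈ S) → HasDisconnectedCut G S
  colouring⇒cut (col , valid , surj) =
    side false , side⊆S ,
    (class (true , false) , class (true , true) , trans (class-split true) side-true ,
     class-disjoint _ , class-nonempty surj _ , class-nonempty surj _ , class-anticomplete _) ,
    (class (false , false) , class (false , true) , class-split false ,
     class-disjoint _ , class-nonempty surj _ , class-nonempty surj _ , class-anticomplete _)
    where open ColouringCut col valid

Outside : ∀ {n} → Subset n → Subset n → Fin n → Set
Outside A B v = v ∉ A × v ∉ B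

record JoinEdge {n} (G : Graph n) (A B : Subset n) (a b : Fin n) : Set where
  field
    disjoint : ∀ {v} → v ∈ A → v ∈ B → Empty
    clique-A : Clique G A
    clique-B : Clique G B
    spread-A : ∀ {r x y} → Outside A B r → x ∈ A → y ∈ A → Adj G r x → Adj G r y
    spread-B : ∀ {r x y} → Outside A B r → x ∈ B → y ∈ B → Adj G r x → Adj G r y
    a∈A : a ∈ A
    b∈B : b ∈ B
    ab : Adj G a b

swap-join : ∀ {n} {G : Graph n} {A B a b} → JoinEdge G A B a b → JoinEdge G B A b a
swap-join {G = G} J = record
  { disjoint = λ v∈B v∈A → disjoint v∈A v∈B
  ; clique-A = clique-B ; clique-B = clique-A
  ; spread-A = λ r-out → spread-B (swap r-out) ; spread-B = λ r-out → spread-A (swap r-out)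
  ; a∈A = b∈B ; b∈B = a∈A ; ab = adj-sym G ab }
  where open JoinEdge J

w-join⇒join-edge : ∀ {n} (G : Graph n) {A B a b} → WJoin G A B →
                   a ∈ A → b ∈ B → Adj G a b → JoinEdge G A B a b
w-join⇒join-edge G {A} {B} (A∩B , _ , _ , _ , clique-A , clique-B , _ , _ , homogeneous) a∈A b∈B ab =
  record
    { disjoint = ∈-disjoint A∩B ; clique-A = clique-A ; clique-B = clique-B
    ; spread-A = λ r-out → spread (proj₁ (homogeneous _ (outside r-out)))
    ; spread-B = λ r-out → spread (proj₂ (homogeneous _ (outside r-out)))
    ; a∈A = a∈A ; b∈B = b∈B ; ab = ab }
  where
  outside : ∀ {r} → Outside A B r → r ∉ A ∪ B
  outside (r∉A , r∉B) r∈ = [ r∉A , r∉B ] (x∈p∪q⁻ A B r∈)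
  spread : ∀ {r C x y} → Complete G ⁅ r ⁆ C ⊎ Anticomplete G ⁅ r ⁆ C →
           x ∈ C → y ∈ C → Adj G r x → Adj G r y
  spread {r} (inj₁ complete)     x∈C y∈C rx = complete (x∈⁅x⁆ r) y∈C
  spread {r} (inj₂ anticomplete) x∈C y∈C rx = ⊥-elim (anticomplete (x∈⁅x⁆ r) x∈C rx)

module Basics {n} {G : Graph n} {A B : Subset n} {a b : Fin n} (J : JoinEdge G A B a b) where
  open JoinEdge J

  Out : Fin n → Set
  Out = Outside A B

  Out? : Decidable Out
  Out? v = ¬? (v ∈? A) ×-dec ¬? (v ∈? B)

  trichotomy : ∀ v → v ∈ A ⊎ v ∈ B ⊎ Out v
  trichotomy v with v ∈? A | v ∈? B
  ... | yes v∈A | _       = inj₁ v∈A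
  ... | no _    | yes v∈B = inj₂ (inj₁ v∈B)
  ... | no v∉A  | no v∉B  = inj₂ (inj₂ (v∉A , v∉B))

  In : Fin n → Set
  In = InGab A B a b

  In-a : In a
  In-a = (λ _ → refl) , (λ a∈B → ⊥-elim (disjoint a∈A a∈B))

  In-b : In b
  In-b = (λ b∈A → ⊥-elim (disjoint b∈A b∈B)) , (λ _ → refl)

  In-out : ∀ {v} → Out v → In v
  In-out (v∉A , v∉B) = (λ v∈A → contradiction v∈A v∉A) , (λ v∈B → contradiction v∈B v∉B)

  paint : Colour → Colour → (Fin n → Colour) → Fin n → Colour
  paint α β col v with v ∈? A | v ∈? B
  ... | yes _ | _     = α
  ... | no _  | yes _ = β
  ... | no _  | no _  = col v

  paint-A : ∀ {α β col v} → v ∈ A → paint α β col v ≡ α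
  paint-A {v = v} v∈A with v ∈? A | v ∈? B
  ... | yes _   | _ = refl
  ... | no v∉A  | _ = contradiction v∈A v∉A

  paint-B : ∀ {α β col v} → v ∈ B → paint α β col v ≡ β
  paint-B {v = v} v∈B with v ∈? A | v ∈? B
  ... | yes v∈A | _       = ⊥-elim (disjoint v∈A v∈B)
  ... | no _    | yes _   = refl
  ... | no _    | no v∉B  = contradiction v∈B v∉B

  paint-out : ∀ {α β col v} → Out v → paint α β col v ≡ col v
  paint-out {v = v} (v∉A , v∉B) with v ∈? A | v ∈? B
  ... | yes v∈A | _       = contradiction v∈A v∉A
  ... | no _    | yes v∈B = contradiction v∈B v∉B
  ... | no _    | no _    = refl

  paint-valid : ∀ {α β} (col : Fin n → Colour) → ¬ Clash α β →
    (∀ {r} → Out r → Adj G a r → ¬ Clash α (col r)) →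
    (∀ {r} → Out r → Adj G b r → ¬ Clash β (col r)) →
    (∀ {u v} → Out u → Out v → Adj G u v → ¬ Clash (col u) (col v)) →
    ∀ {u v} → Adj G u v → ¬ Clash (paint α β col u) (paint α β col v)
  paint-valid {α} {β} col α-β a-out b-out out-out {u} {v} uv
    with trichotomy u | trichotomy v
  ... | inj₁ u∈A        | inj₁ v∈A        = no-clash-resp (paint-A u∈A) (paint-A v∈A) no-self-clash
  ... | inj₁ u∈A        | inj₂ (inj₁ v∈B) = no-clash-resp (paint-A u∈A) (paint-B v∈B) α-β
  ... | inj₂ (inj₁ u∈B) | inj₁ v∈A        = no-clash-resp (paint-B u∈B) (paint-A v∈A) (α-β ∘ clash-sym)
  ... | inj₂ (inj₁ u∈B) | inj₂ (inj₁ v∈B) = no-clash-resp (paint-B u∈B) (paint-B v∈B) no-self-clash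
  ... | inj₁ u∈A        | inj₂ (inj₂ v-out) = no-clash-resp (paint-A u∈A) (paint-out v-out)
        (a-out v-out (adj-sym G (spread-A v-out u∈A a∈A (adj-sym G uv))))
  ... | inj₂ (inj₂ u-out) | inj₁ v∈A      = no-clash-resp (paint-out u-out) (paint-A v∈A)
        (a-out u-out (adj-sym G (spread-A u-out v∈A a∈A uv)) ∘ clash-sym)
  ... | inj₂ (inj₁ u∈B) | inj₂ (inj₂ v-out) = no-clash-resp (paint-B u∈B) (paint-out v-out)
        (b-out v-out (adj-sym G (spread-B v-out u∈B b∈B (adj-sym G uv))))
  ... | inj₂ (inj₂ u-out) | inj₂ (inj₁ v∈B) = no-clash-resp (paint-out u-out) (paint-B v∈B)
        (b-out u-out (adj-sym G (spread-B u-out v∈B b∈B uv)) ∘ clash-sym)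
  ... | inj₂ (inj₂ u-out) | inj₂ (inj₂ v-out) = no-clash-resp (paint-out u-out) (paint-out v-out)
        (out-out u-out v-out uv)

outsider : ∀ {n} {G : Graph n} {A B a b} → ¬ Cobipartite G → JoinEdge G A B a b → ∃ (Outside A B)
outsider {A = A} {B} not-cobipartite J with any? (Basics.Out? J)
... | yes found = found
... | no none   = ⊥-elim (not-cobipartite (A , B , covered , A∩B≡⊥ , clique-A , clique-B))
  where
  open JoinEdge J
  open Basics J
  covered : A ∪ B ≡ ⊤
  covered = ⊆-antisym ⊆⊤ λ {v} _ → x∈p∪q⁺ (in-A-or-B v)
    where
    in-A-or-B : ∀ v → v ∈ A ⊎ v ∈ B
    in-A-or-B v with trichotomy v
    ... | inj₁ v∈A          = inj₁ v∈A
    ... | inj₂ (inj₁ v∈B)   = inj₂ v∈B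
    ... | inj₂ (inj₂ v-out) = ⊥-elim (none (v , v-out))
  A∩B≡⊥ : A ∩ B ≡ ⊥
  A∩B≡⊥ = Empty-unique λ { (v , v∈) → let (v∈A , v∈B) = x∈p∩q⁻ A B v∈ in disjoint v∈A v∈B }

-- With diameter 2 and distinct neighbourhoods, no outside vertex r belongs to a class C of
-- outside vertices that is anticomplete to B and closed under adjacency outside A ∪ B:
-- every member of C reaches b in two steps only through A, so is complete to A, and then
-- N(r) \ {a} ⊆ N(a).
lonely : ∀ {n} {G : Graph n} → (∀ u v → Dist≤2 G u v) → DistinctNeighbourhoods G →
  ∀ {A B a b} → JoinEdge G A B a b → (C : Fin n → Set) →
  (∀ {r} → Outside A B r → C r → ∀ {z} → z ∈ B → ¬ Adj G r z) →
  (∀ {r w} → Outside A B r → Outside A B w → C r → Adj G r w → C w) →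
  ∀ {r} → Outside A B r → C r → Empty
lonely {G = G} diam distinct {a = a} {b} J C C-misses-B C-closed {r} r-out r∈C =
  no-dominated-neighbour G distinct (sees-a r-out r∈C) a-dominates
  where
  open JoinEdge J
  open Basics J
  sees-a : ∀ {s} → Out s → C s → Adj G s a
  sees-a {s} s-out s∈C with diam s b
  ... | inj₁ refl      = ⊥-elim (proj₂ s-out b∈B)
  ... | inj₂ (inj₁ sb) = ⊥-elim (C-misses-B s-out s∈C b∈B sb)
  ... | inj₂ (inj₂ (w , sw , wb)) with trichotomy w
  ...   | inj₁ w∈A          = spread-A s-out w∈A a∈A sw
  ...   | inj₂ (inj₁ w∈B)   = ⊥-elim (C-misses-B s-out s∈C w∈B sw)
  ...   | inj₂ (inj₂ w-out) = ⊥-elim (C-misses-B w-out (C-closed s-out w-out s∈C sw) b∈B wb)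
  a-dominates : ∀ {w} → Adj G r w → w ≢ a → Adj G a w
  a-dominates {w} rw w≢a with trichotomy w
  ... | inj₁ w∈A          = clique-A a∈A w∈A (w≢a ∘ sym)
  ... | inj₂ (inj₁ w∈B)   = ⊥-elim (C-misses-B r-out r∈C w∈B rw)
  ... | inj₂ (inj₂ w-out) = adj-sym G (sees-a w-out (C-closed r-out w-out r∈C rw))

module Coloured {n} {G : Graph n} (diam : ∀ u v → Dist≤2 G u v)
  (distinct : DistinctNeighbourhoods G) (not-cobipartite : ¬ Cobipartite G)
  {A B : Subset n} {a b : Fin n} (J : JoinEdge G A B a b)
  (col : Fin n → Colour) (valid : ∀ {u v} → Adj G u v → ¬ Clash (col u) (col v))
  (surj : ∀ k → ∃[ v ] (col v ≡ k)) where
  open JoinEdge J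
  open Basics J

  apart : ∀ {u v k l} → Adj G u v → col u ≡ k → col v ≡ l → ¬ Clash k l
  apart uv refl refl = valid uv

  clique-clash : ∀ {S u v} → Clique G S → u ∈ S → v ∈ S → ¬ Clash (col u) (col v)
  clique-clash S-clique u∈S v∈S clash =
    valid (S-clique u∈S v∈S λ { refl → no-self-clash clash }) clash

  opposite-misses-A : ∀ {y} → Out y → col y ≡ opp (col a) → ∀ {z} → z ∈ A → ¬ Adj G y z
  opposite-misses-A y-out ey z∈A yz = apart (spread-A y-out z∈A a∈A yz) ey refl (clash-sym refl)

  -- When a and b share a colour, a vertex y of the opposite colour lies outside
  -- A ∪ B and misses A ∪ B; a vertex p of A coloured from the other pair then has a
  -- common neighbour with y outside A ∪ B, and that neighbour has the colour of p.
  relay : ∀ {y p} → col a ≡ col b → Out y → col y ≡ opp (col a) →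
          p ∈ A → pair (col a) ≢ pair (col p) → ∃[ w ] (Out w × col w ≡ col p)
  relay {y} {p} same y-out ey p∈A pair≢ with diam y p
  ... | inj₁ refl      = ⊥-elim (proj₁ y-out p∈A)
  ... | inj₂ (inj₁ yp) = ⊥-elim (opposite-misses-A y-out ey p∈A yp)
  ... | inj₂ (inj₂ (w , yw , wp)) with trichotomy w
  ...   | inj₁ w∈A        = ⊥-elim (opposite-misses-A y-out ey w∈A yw)
  ...   | inj₂ (inj₁ w∈B) = ⊥-elim (apart (spread-B y-out w∈B b∈B yw) ey (sym same) (clash-sym refl))
  ...   | inj₂ (inj₂ w-out) with four-colours pair≢ (col w)
  ...     | inj₁ e                = ⊥-elim (apart yw ey e (clash-sym refl))
  ...     | inj₂ (inj₁ e)         = ⊥-elim (apart (spread-A w-out p∈A a∈A wp) e refl (clash-sym refl))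
  ...     | inj₂ (inj₂ (inj₁ e))  = w , w-out , e
  ...     | inj₂ (inj₂ (inj₂ e))  = ⊥-elim (apart wp e refl (clash-sym refl))

  -- What is needed to recolour A with opp (col b) and B with opp (col a).
  record Recolourable : Set where
    field
      outside-a : ∃[ r ] (Out r × col r ≡ col a)
      outside-b : ∃[ r ] (Out r × col r ≡ col b)
      b-coloured-miss-a : ∀ {r} → Out r → col r ≡ col b → ¬ Adj G a r
      a-coloured-miss-b : ∀ {r} → Out r → col r ≡ col a → ¬ Adj G b r

  module NoOppositeOutside (pair≢ : pair (col a) ≢ pair (col b))
                           (no-opp-a : ∀ {r} → Out r → col r ≢ opp (col a)) where

    exclude : ∀ {v} → col v ≢ col a → col v ≢ opp (col a) → col v ≢ col b → col v ≢ opp (col b) → Empty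
    exclude = no-fifth-colour pair≢

    y : Fin n
    y = proj₁ (surj (opp (col a)))

    ey : col y ≡ opp (col a)
    ey = proj₂ (surj (opp (col a)))

    y∈B : y ∈ B
    y∈B with trichotomy y
    ... | inj₁ y∈A          = ⊥-elim (clique-clash clique-A a∈A y∈A ey)
    ... | inj₂ (inj₁ y∈B)   = y∈B
    ... | inj₂ (inj₂ y-out) = ⊥-elim (no-opp-a y-out ey)

    -- an outside vertex with a neighbour in B is adjacent to b
    B-neighbour : ∀ {w z} → Out w → Adj G w z → z ∈ B → col w ≢ opp (col b)
    B-neighbour w-out wz z∈B e = apart (spread-B w-out z∈B b∈B wz) e refl (clash-sym refl)

    A-avoids-opp-a : ∀ {v} → v ∈ A → col v ≢ opp (col a)
    A-avoids-opp-a v∈A = clique-clash clique-A a∈A v∈A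

    -- no vertex of A has the colour of b: otherwise a vertex p of the opposite colour
    -- lies outside A ∪ B, and no vertex can join p to y.
    A-avoids-b : ∀ {v} → v ∈ A → col v ≢ col b
    A-avoids-b {a₀} a₀∈A e₀ with surj (opp (col b))
    ... | p , ep with trichotomy p
    ...   | inj₁ p∈A        = clique-clash clique-A a₀∈A p∈A (trans ep (cong opp (sym e₀)))
    ...   | inj₂ (inj₁ p∈B) = clique-clash clique-B b∈B p∈B ep
    ...   | inj₂ (inj₂ p-out) with diam p y
    ...     | inj₁ refl      = proj₂ p-out y∈B
    ...     | inj₂ (inj₁ py) = B-neighbour p-out py y∈B ep
    ...     | inj₂ (inj₂ (w , pw , wy)) with trichotomy w
    ...       | inj₁ w∈A = exclude (λ e → apart wy e ey refl) (A-avoids-opp-a w∈A)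
                  (λ e → apart pw ep e (clash-sym refl))
                  (λ e → clique-clash clique-A a₀∈A w∈A (trans e (cong opp (sym e₀))))
    ...       | inj₂ (inj₁ w∈B)   = B-neighbour p-out pw w∈B ep
    ...       | inj₂ (inj₂ w-out) = exclude (λ e → apart wy e ey refl) (no-opp-a w-out)
                  (λ e → apart pw ep e (clash-sym refl)) (B-neighbour w-out wy y∈B)

    -- some vertex of A has the colour opposite to b: otherwise N(y) \ {b} ⊆ N(b)
    A-opp-b : ∃[ a′ ] (a′ ∈ A × col a′ ≡ opp (col b))
    A-opp-b with any? (λ v → (v ∈? A) ×-dec (col v ≟ᶜ opp (col b)))
    ... | yes found = found
    ... | no none   = ⊥-elim (no-dominated-neighbour G distinct yb b-dominates)
      where
      yb : Adj G y b
      yb = clique-B y∈B b∈B λ y≡b → pair≢ (cong pair (trans (sym ey) (cong col y≡b)))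
      b-dominates : ∀ {w} → Adj G y w → w ≢ b → Adj G b w
      b-dominates {w} yw w≢b with trichotomy w
      ... | inj₁ w∈A = ⊥-elim (exclude (λ e → apart yw ey e (clash-sym refl)) (A-avoids-opp-a w∈A)
                                 (A-avoids-b w∈A) (λ e → none (w , w∈A , e)))
      ... | inj₂ (inj₁ w∈B)   = clique-B b∈B w∈B (w≢b ∘ sym)
      ... | inj₂ (inj₂ w-out) = adj-sym G (spread-B w-out y∈B b∈B (adj-sym G yw))

    -- an outside neighbour of a sees a′ (coloured opp (col b)); one of b sees y
    b-coloured-miss-a : ∀ {r} → Out r → col r ≡ col b → ¬ Adj G a r
    b-coloured-miss-a r-out e ar =
      let (a′ , a′∈A , ea′) = A-opp-b in
      apart (spread-A r-out a∈A a′∈A (adj-sym G ar)) e ea′ refl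

    a-coloured-miss-b : ∀ {r} → Out r → col r ≡ col a → ¬ Adj G b r
    a-coloured-miss-b r-out e br = apart (spread-B r-out b∈B y∈B (adj-sym G br)) e ey refl

    -- the colour of b occurs outside A ∪ B: otherwise all outside vertices miss B
    outside-b : ∃[ r ] (Out r × col r ≡ col b)
    outside-b with any? (λ v → Out? v ×-dec (col v ≟ᶜ col b))
    ... | yes found = found
    ... | no none   = ⊥-elim (lonely diam distinct J (λ _ → Unit) misses-B (λ _ _ _ _ → tt)
                                (proj₂ (outsider not-cobipartite J)) tt)
      where
      misses-B : ∀ {r} → Out r → Unit → ∀ {z} → z ∈ B → ¬ Adj G r z
      misses-B {r} r-out _ z∈B rz = exclude
        (λ e → a-coloured-miss-b r-out e (adj-sym G (spread-B r-out z∈B b∈B rz)))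
        (no-opp-a r-out) (λ e → none (r , r-out , e)) (B-neighbour r-out rz z∈B)

    -- the colour of a occurs outside A ∪ B: otherwise the outside vertices of colour
    -- opp (col b) miss B and those of colour col b miss A, and both classes are lonely
    outside-a : ∃[ r ] (Out r × col r ≡ col a)
    outside-a with any? (λ v → Out? v ×-dec (col v ≟ᶜ col a))
    ... | yes found = found
    ... | no none with outsider not-cobipartite J
    ...   | r , r-out = ⊥-elim (exclude (λ e → none (r , r-out , e)) (no-opp-a r-out)
                          (λ e → lonely diam distinct (swap-join J) (λ s → col s ≡ col b)
                                   b-coloured-misses-A b-coloured-closed (swap r-out) e)
                          (lonely diam distinct J (λ s → col s ≡ opp (col b))
                                   (λ s-out e z∈B sz → B-neighbour s-out sz z∈B e)
                                   opp-b-coloured-closed r-out))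
      where
      outside-colour : ∀ {w} → Out w → col w ≡ col b ⊎ col w ≡ opp (col b)
      outside-colour {w} w-out with four-colours pair≢ (col w)
      ... | inj₁ e        = ⊥-elim (none (w , w-out , e))
      ... | inj₂ (inj₁ e) = ⊥-elim (no-opp-a w-out e)
      ... | inj₂ (inj₂ s) = s
      b-coloured-misses-A : ∀ {s} → Outside B A s → col s ≡ col b → ∀ {z} → z ∈ A → ¬ Adj G s z
      b-coloured-misses-A s-out e z∈A sz =
        b-coloured-miss-a (swap s-out) e (adj-sym G (spread-A (swap s-out) z∈A a∈A sz))
      b-coloured-closed : ∀ {s w} → Outside B A s → Outside B A w → col s ≡ col b →
                          Adj G s w → col w ≡ col b
      b-coloured-closed s-out w-out e sw with outside-colour (swap w-out)
      ... | inj₁ e′ = e′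
      ... | inj₂ e′ = ⊥-elim (apart sw e e′ refl)
      opp-b-coloured-closed : ∀ {s w} → Out s → Out w → col s ≡ opp (col b) →
                              Adj G s w → col w ≡ opp (col b)
      opp-b-coloured-closed s-out w-out e sw with outside-colour w-out
      ... | inj₁ e′ = ⊥-elim (apart sw e e′ (clash-sym refl))
      ... | inj₂ e′ = e′

    recolourable : Recolourable
    recolourable = record
      { outside-a = outside-a ; outside-b = outside-b
      ; b-coloured-miss-a = b-coloured-miss-a ; a-coloured-miss-b = a-coloured-miss-b }

module Transfer {n} {G : Graph n} (diam : ∀ u v → Dist≤2 G u v)
  (distinct : DistinctNeighbourhoods G) (not-cobipartite : ¬ Cobipartite G)
  {A B : Subset n} {a b : Fin n} (J : JoinEdge G A B a b) where
  open JoinEdge J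
  open Basics J

  backward : Colouring G In → Colouring G (_∈ ⊤)
  backward (col , valid , surj) =
    paint (col a) (col b) col ,
    (λ _ _ → paint-valid col (valid In-a In-b ab)
               (λ r-out → valid In-a (In-out r-out)) (λ r-out → valid In-b (In-out r-out))
               (λ u-out v-out → valid (In-out u-out) (In-out v-out))) ,
    extended
    where
    extended : Surjective G (_∈ ⊤) (paint (col a) (col b) col)
    extended k with surj k
    ... | v , v-in , refl with trichotomy v
    ...   | inj₁ v∈A          = v , ∈⊤ , trans (paint-A v∈A) (cong col (sym (proj₁ v-in v∈A)))
    ...   | inj₂ (inj₁ v∈B)   = v , ∈⊤ , trans (paint-B v∈B) (cong col (sym (proj₂ v-in v∈B)))
    ...   | inj₂ (inj₂ v-out) = v , ∈⊤ , paint-out v-out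

  module Restrict (col : Fin n → Colour) (valid : ∀ {u v} → Adj G u v → ¬ Clash (col u) (col v))
                  (surj : ∀ k → ∃[ v ] (col v ≡ k)) where
    open Coloured diam distinct not-cobipartite J col valid surj
    module Swapped = Coloured diam distinct not-cobipartite (swap-join J) col valid surj

    kept : ∀ {k} → ∃[ w ] (Out w × col w ≡ k) → ∃[ w ] (In w × col w ≡ k)
    kept (w , w-out , e) = w , In-out w-out , e

    monochrome : col a ≡ col b → Surjective G In col
    monochrome same k with surj (opp (col a))
    ... | y , ey with trichotomy y
    ...   | inj₁ y∈A        = ⊥-elim (clique-clash clique-A a∈A y∈A ey)
    ...   | inj₂ (inj₁ y∈B) = ⊥-elim (clique-clash clique-B b∈B y∈B (trans ey (cong opp same)))
    ...   | inj₂ (inj₂ y-out) with pair (col a) ≟ᵇ pair k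
    ...     | yes pair≡ with same-pair {col a} {k} (sym pair≡)
    ...       | inj₁ refl = a , In-a , refl
    ...       | inj₂ refl = y , In-out y-out , ey
    monochrome same k | y , ey | inj₂ (inj₂ y-out) | no pair≢ with surj k
    ... | p , refl with trichotomy p
    ...   | inj₁ p∈A          = kept (relay same y-out ey p∈A pair≢)
    ...   | inj₂ (inj₁ p∈B)   = let (w , w-out , e) = Swapped.relay (sym same) (swap y-out)
                                      (trans ey (cong opp same)) p∈B (pair≢ ∘ trans (cong pair same))
                                in w , In-out (swap w-out) , e
    ...   | inj₂ (inj₂ p-out) = p , In-out p-out , refl

    rainbow : pair (col a) ≢ pair (col b) → ∃[ y ] (Out y × col y ≡ opp (col a)) →
              ∃[ p ] (Out p × col p ≡ opp (col b)) → Surjective G In col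
    rainbow pair≢ opp-a opp-b k with four-colours {col a} {col b} pair≢ k
    ... | inj₁ refl                = a , In-a , refl
    ... | inj₂ (inj₁ refl)         = kept opp-a
    ... | inj₂ (inj₂ (inj₁ refl))  = b , In-b , refl
    ... | inj₂ (inj₂ (inj₂ refl))  = kept opp-b

    swap-recolourable : Swapped.Recolourable → Recolourable
    swap-recolourable R = record
      { outside-a = let (r , r-out , e) = S.outside-b in r , swap r-out , e
      ; outside-b = let (r , r-out , e) = S.outside-a in r , swap r-out , e
      ; b-coloured-miss-a = λ r-out → S.a-coloured-miss-b (swap r-out)
      ; a-coloured-miss-b = λ r-out → S.b-coloured-miss-a (swap r-out) }
      where module S = Swapped.Recolourable R

    recolour : pair (col a) ≢ pair (col b) → Recolourable → Colouring G In
    recolour pair≢ R =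
      paint (opp (col b)) (opp (col a)) col ,
      (λ _ _ → paint-valid col (cross-pair (pair≢ ∘ sym))
                 (λ r-out ar e → b-coloured-miss-a r-out (trans e (opp-involutive (col b))) ar)
                 (λ r-out br e → a-coloured-miss-b r-out (trans e (opp-involutive (col a))) br)
                 (λ _ _ → valid)) ,
      repainted
      where
      open Recolourable R
      repainted : Surjective G In (paint (opp (col b)) (opp (col a)) col)
      repainted k with four-colours {col a} {col b} pair≢ k
      ... | inj₁ refl = let (r , r-out , e) = outside-a in r , In-out r-out , trans (paint-out r-out) e
      ... | inj₂ (inj₁ refl) = b , In-b , paint-B b∈B
      ... | inj₂ (inj₂ (inj₁ refl)) = let (r , r-out , e) = outside-b in r , In-out r-out , trans (paint-out r-out) e
      ... | inj₂ (inj₂ (inj₂ refl)) = a , In-a , paint-A a∈A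

    restricted : Colouring G In
    restricted with pair (col a) ≟ᵇ pair (col b)
    ... | yes pair≡ with same-pair {col a} {col b} (sym pair≡)
    ...   | inj₁ same = col , (λ _ _ → valid) , monochrome (sym same)
    ...   | inj₂ clash = ⊥-elim (valid ab clash)
    restricted | no pair≢
      with any? (λ v → Out? v ×-dec (col v ≟ᶜ opp (col a)))
         | any? (λ v → Out? v ×-dec (col v ≟ᶜ opp (col b)))
    ... | yes opp-a | yes opp-b = col , (λ _ _ → valid) , rainbow pair≢ opp-a opp-b
    ... | no none   | _         = recolour pair≢
          (NoOppositeOutside.recolourable pair≢ λ r-out e → none (_ , r-out , e))
    ... | yes _     | no none   = recolour pair≢ (swap-recolourable
          (Swapped.NoOppositeOutside.recolourable (pair≢ ∘ sym) λ r-out e → none (_ , swap r-out , e)))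

  forward : Colouring G (_∈ ⊤) → Colouring G In
  forward (col , valid , surj) =
    Restrict.restricted col (valid ∈⊤ ∈⊤) (λ k → let (v , _ , e) = surj k in v , e)

lemma15 : ∀ {n} (G : Graph n) → ClawFree G → ¬ Cobipartite G →
          DistinctNeighbourhoods G → Diameter2 G →
          (A B : Subset n) → Unshatterable G A B →
          ∀ a b → a ∈ A → b ∈ B → Adj G a b →
          (HasDisconnectedCut G ⊤ → HasDisconnectedCut G (Gab G A B a b)) ×
          (HasDisconnectedCut G (Gab G A B a b) → HasDisconnectedCut G ⊤)
lemma15 G _ not-cobipartite distinct diameter A B unshatterable a b a∈A b∈B ab =
    (λ cut → colouring⇒cut G (to-Gab (forward (cut⇒colouring G cut))))
  , (λ cut → colouring⇒cut G (backward (from-Gab (cut⇒colouring G cut))))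
  where
  w-join : WJoin G A B
  w-join = proj₁ (proj₁ unshatterable)
  open Transfer (proj₁ diameter) distinct not-cobipartite (w-join⇒join-edge G w-join a∈A b∈B ab)
  to-Gab : Colouring G (InGab A B a b) → Colouring G (_∈ Gab G A B a b)
  to-Gab = colouring-resp G (InGab⇒∈Gab G) (∈Gab⇒InGab G)
  from-Gab : Colouring G (_∈ Gab G A B a b) → Colouring G (InGab A B a b)
  from-Gab = colouring-resp G (∈Gab⇒InGab G) (InGab⇒∈Gab G)
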